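{- Let $\mathbf{L}$ be a Euclidean modal logic and let $\mathcal{F}^\rho_{A,B}$ be a galaxy in $\mathcal{K}_2$. If $\{2\}\times\mathbf{N}^{ - }\subseteq\mathtt{S}_{\mathbf{L}}$, then $\mathcal{F}^\rho_{A,B}$ validates $\mathbf{L}$.
   Context: A frame is a pair $(W,R)$ with $W$ non-empty and $R\subseteq W\times W$. Modal formulas are built from propositional variables, $\bot$, $\neg$, $\vee$, $\Box$ with Kripke semantics; validity means truth at every point under every valuation. A (normal) modal logic is a set of modal formulas containing all tautologies and all instances of $\Box(\varphi\to\psi)\to(\Box\varphi\to\Box\psi)$, closed under uniform substitution, modus ponens and necessitation; consistent means not containing $\bot$. A Euclidean modal logic is a consistent modal logic containing $\Diamond\varphi\to\Box\Diamond\varphi$ for all $\varphi$. For disjoint sets $A,B$ with $A\cup B\neq\emptyset$ and $\rho:A\to\mathcal{P}(B)$, the galaxy $\mathcal{F}^\rho_{A,B}$ is the frame with universe $A\cup B$ and relation $\bigcup_{s\in A}(\{s\}\times\rho(s))\cup(B\times B)$. $\mathcal{K}_2$ is the class of galaxies with $|A|\geq4$, $|B|\geq4$ and $|\rho(s)|=2$ for all $s\in A$. $\mathbf{N}^{+}=\mathbb{N}\setminus\{0\}$, $\mathbf{N}^{ - }=\mathbb{N}\cup\{ -1\}$. For $m\in\mathbf{N}^{+}$, $n\in\mathbf{N}^{ - }$ the flower $\mathcal{F}_m^n$ is: if $n\in\mathbb{N}$, universe $\{0,\dots,m+n\}$ with relation $(\{0\}\times\{1,\dots,m\})\cup(\{1,\dots,m+n\}\times\{1,\dots,m+n\})$;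 if $n=-1$, universe $\{1,\dots,m\}$ with the universal relation. $\mathtt{S}_{\mathbf{L}}=\{(m,n)\in\mathbf{N}^{+}\times\mathbf{N}^{ - }:\mathcal{F}_m^n\text{ validates }\mathbf{L}\}$. -}

module Defs where

open import Level using (0ℓ)
open import Data.Nat using (ℕ; zero; suc; _+_; _≤_)
open import Data.Bool using (Bool; true; false; not; _∨_)
open import Data.Fin using (Fin)
open import Data.Sum using (_⊎_; inj₁; inj₂)
open import Data.Product using (Σ; _×_; _,_; ∃-syntax)
open import Data.Unit using (⊤)
open import Data.Empty using (⊥)
open import Relation.Nullary using (¬_)
open import Relation.Binary.PropositionalEquality using (_≡_; _≢_)
open import Function.Definitions using (Injective)
open import Function.Bundles using (_⇔_)

data Fm : Set where
  var  : ℕ → Fm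
  ⊥'   : Fm
  ¬'_  : Fm → Fm
  _∨'_ : Fm → Fm → Fm
  □_   : Fm → Fm

infixr 6 _∨'_
infix 7 ¬'_ □_ ◇_
infixr 5 _⇒_

_⇒_ : Fm → Fm → Fm
φ ⇒ ψ = (¬' φ) ∨' ψ

◇_ : Fm → Fm
◇ φ = ¬' (□ (¬' φ))

subst : (ℕ → Fm) → Fm → Fm
subst σ (var p)  = σ p
subst σ ⊥'       = ⊥'
subst σ (¬' φ)   = ¬' subst σ φ
subst σ (φ ∨' ψ) = subst σ φ ∨' subst σ ψ
subst σ (□ φ)    = □ subst σ φ

-- propositional (Boolean) evaluation, treating boxed subformulas as atoms
peval : (ℕ → Bool) → (Fm → Bool) → Fm → Bool
peval f g (var p)  = f p
peval f g ⊥'       = false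
peval f g (¬' φ)   = not (peval f g φ)
peval f g (φ ∨' ψ) = peval f g φ ∨ peval f g ψ
peval f g (□ φ)    = g φ

Tautology : Fm → Set
Tautology φ = ∀ (f : ℕ → Bool) (g : Fm → Bool) → peval f g φ ≡ true

record IsModalLogic (L : Fm → Set) : Set where
  field
    taut  : ∀ φ → Tautology φ → L φ
    axK   : ∀ φ ψ → L (□ (φ ⇒ ψ) ⇒ (□ φ ⇒ □ ψ))
    usubst : ∀ σ φ → L φ → L (subst σ φ)
    mp    : ∀ φ ψ → L (φ ⇒ ψ) → L φ → L ψ
    nec   : ∀ φ → L φ → L (□ φ)

Consistent : (Fm → Set) → Set
Consistent L = ¬ L ⊥'

record EuclideanLogic (L : Fm → Set) : Set where
  field
    isLogic    : IsModalLogic L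
    consistent : Consistent L
    axE        : ∀ φ → L (◇ φ ⇒ □ (◇ φ))

record Frame : Set₁ where
  field
    W : Set
    R : W → W → Set
open Frame public

Valuation : Frame → Set₁
Valuation F = ℕ → W F → Set

Sat : (F : Frame) → Valuation F → W F → Fm → Set
Sat F V w (var p)  = V p w
Sat F V w ⊥'       = ⊥
Sat F V w (¬' φ)   = ¬ Sat F V w φ
Sat F V w (φ ∨' ψ) = Sat F V w φ ⊎ Sat F V w ψ
Sat F V w (□ φ)    = ∀ v → R F w v → Sat F V v φ

ValidIn : Frame → Fm → Set₁
ValidIn F φ = ∀ (V : Valuation F) (w : W F) → Sat F V w φ

Validates : Frame → (Fm → Set) → Set₁
Validates F L = ∀ φ → L φ → ValidIn F φ

-- Galaxies: universe A ∪ B (A, B disjoint, so modelled as A ⊎ B)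

galaxyR : {A B : Set} → (A → B → Set) → A ⊎ B → A ⊎ B → Set
galaxyR ρ (inj₁ s) (inj₁ _) = ⊥
galaxyR ρ (inj₁ s) (inj₂ b) = ρ s b
galaxyR ρ (inj₂ _) (inj₁ _) = ⊥
galaxyR ρ (inj₂ _) (inj₂ _) = ⊤

galaxy : (A B : Set) → (A → B → Set) → Frame
galaxy A B ρ = record { W = A ⊎ B ; R = galaxyR ρ }

AtLeast : ℕ → Set → Set
AtLeast n X = Σ (Fin n → X) Injective'
  where Injective' : (Fin n → X) → Set
        Injective' f = Injective _≡_ _≡_ f

ExactlyTwo : {X : Set} → (X → Set) → Set
ExactlyTwo {X} P = ∃[ x ] ∃[ y ] (x ≢ y × (∀ z → P z ⇔ (z ≡ x ⊎ z ≡ y)))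

InK2 : (A B : Set) → (A → B → Set) → Set
InK2 A B ρ = AtLeast 4 A × AtLeast 4 B × (∀ s → ExactlyTwo (ρ s))

data N⁻ : Set where
  minus1 : N⁻
  nat    : ℕ → N⁻

flowerW : ℕ → N⁻ → Set
flowerW m minus1  = Σ ℕ λ i → 1 ≤ i × i ≤ m
flowerW m (nat n) = Σ ℕ λ i → i ≤ m + n

flowerR : (m : ℕ) (n : N⁻) → flowerW m n → flowerW m n → Set
flowerR m minus1  _ _ = ⊤
flowerR m (nat n) (i , _) (j , _) = (i ≡ 0 × 1 ≤ j × j ≤ m) ⊎ (1 ≤ i × 1 ≤ j)

flower : ℕ → N⁻ → Frame
flower m n = record { W = flowerW m n ; R = flowerR m n }

InS : (Fm → Set) → ℕ → N⁻ → Set₁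
InS L m n = (1 ≤ m) × Validates (flower m n) L

{-# OPTIONS --safe #-}
-- Fix φ and a valuation on the galaxy, and let N bound the variables of φ.
-- Points of B see exactly B, so two of them that agree on the variables below N
-- satisfy the same such formulas; by excluded middle B has finitely many
-- representatives rs up to this agreement. For s ∈ A with ρ(s) = {b₁, b₂}, the
-- flower 𝓕₂ⁿ with n = |rs| maps onto the galaxy by 0 ↦ s, 1 ↦ b₁, 2 ↦ b₂ and the
-- remaining petals ↦ rs. Up to agreement below N this map is a bounded morphism
-- hitting s and the class of every b ∈ B, so validity of φ on 𝓕₂ⁿ carries over to
-- the galaxy.
module Submission where

open import Level using (0ℓ)
open import Axiom.ExcludedMiddle using (ExcludedMiddle)
open import Defs
open import Data.Nat using (ℕ; zero; suc; _+_; _≤_; _<_; _⊔_; z≤n; s≤s)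
open import Data.Nat.Properties using (≤-trans; ≤-refl; m≤m⊔n; m≤n⊔m; m<1+n⇒m<n∨m≡n)
open import Data.Fin as Fin using (Fin; toℕ; fromℕ<)
open import Data.Fin.Properties using (toℕ<n; fromℕ<-toℕ)
open import Data.List using (List; []; _∷_; _++_; concatMap; length; lookup)
open import Data.List.Relation.Unary.Any as Any using (Any; here)
open import Data.List.Relation.Unary.Any.Properties using (++⁺ˡ; ++⁺ʳ; concatMap⁺; lookup-index)
open import Data.Sum using (_⊎_; inj₁; inj₂)
open import Data.Sum.Function.Propositional using (_⊎-⇔_)
open import Data.Product using (_×_; _,_; proj₁; proj₂; ∃; ∃-syntax)
open import Data.Unit using (⊤; tt)
open import Data.Empty using (⊥-elim)
open import Function using (_∘_; const)
open import Function.Bundles using (_⇔_; mk⇔; Equivalence)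
open import Function.Properties.Equivalence using () renaming (refl to ⇔-refl; sym to ⇔-sym; trans to ⇔-trans)
open import Function.Related.TypeIsomorphisms using (¬-cong-⇔)
open import Relation.Nullary using (¬_; yes; no)
open import Relation.Binary.PropositionalEquality as ≡ using (_≡_; refl)

VarsBelow : ℕ → Fm → Set
VarsBelow N (var p)  = p < N
VarsBelow N ⊥'       = ⊤
VarsBelow N (¬' φ)   = VarsBelow N φ
VarsBelow N (φ ∨' ψ) = VarsBelow N φ × VarsBelow N ψ
VarsBelow N (□ φ)    = VarsBelow N φ

varBound : Fm → ℕ
varBound (var p)  = suc p
varBound ⊥'       = 0
varBound (¬' φ)   = varBound φ
varBound (φ ∨' ψ) = varBound φ ⊔ varBound ψ
varBound (□ φ)    = varBound φ

VarsBelow-mono : ∀ {M N} φ → M ≤ N → VarsBelow M φ → VarsBelow N φ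
VarsBelow-mono (var p)  M≤N p<M         = ≤-trans p<M M≤N
VarsBelow-mono ⊥'       M≤N _           = tt
VarsBelow-mono (¬' φ)   M≤N φ<M         = VarsBelow-mono φ M≤N φ<M
VarsBelow-mono (φ ∨' ψ) M≤N (φ<M , ψ<M) = VarsBelow-mono φ M≤N φ<M , VarsBelow-mono ψ M≤N ψ<M
VarsBelow-mono (□ φ)    M≤N φ<M         = VarsBelow-mono φ M≤N φ<M

VarsBelow-varBound : ∀ φ → VarsBelow (varBound φ) φ
VarsBelow-varBound (var p)  = ≤-refl
VarsBelow-varBound ⊥'       = tt
VarsBelow-varBound (¬' φ)   = VarsBelow-varBound φ
VarsBelow-varBound (φ ∨' ψ) =
  VarsBelow-mono φ (m≤m⊔n (varBound φ) (varBound ψ)) (VarsBelow-varBound φ) ,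
  VarsBelow-mono ψ (m≤n⊔m (varBound φ) (varBound ψ)) (VarsBelow-varBound ψ)
VarsBelow-varBound (□ φ)    = VarsBelow-varBound φ

module _ {X : Set} (P : ℕ → X → Set) where

  AgreeBelow : ℕ → X → X → Set
  AgreeBelow N x y = ∀ p → p < N → P p x ⇔ P p y

  AgreeBelow-sym : ∀ {N x y} → AgreeBelow N x y → AgreeBelow N y x
  AgreeBelow-sym x~y p p<N = ⇔-sym (x~y p p<N)

  AgreeBelow-trans : ∀ {N x y z} → AgreeBelow N x y → AgreeBelow N y z → AgreeBelow N x z
  AgreeBelow-trans x~y y~z p p<N = ⇔-trans (x~y p p<N) (y~z p p<N)

  AgreeBelow-extend : ∀ {N x y} → AgreeBelow N x y → (P N x ⇔ P N y) → AgreeBelow (suc N) x y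
  AgreeBelow-extend x~y Px⇔Py p p<1+N with m<1+n⇒m<n∨m≡n p<1+N
  ... | inj₁ p<N = x~y p p<N
  ... | inj₂ refl = Px⇔Py

module _ (em : ExcludedMiddle 0ℓ) {X : Set} where

  sample : (Q : X → Set) → List X
  sample Q with em {∃ Q}
  ... | yes (x , _) = x ∷ []
  ... | no _        = []

  sample-complete : (Q : X → Set) → ∀ {x} → Q x → Any Q (sample Q)
  sample-complete Q {x} Qx with em {∃ Q}
  ... | yes (_ , Qy) = here Qy
  ... | no ∄Q        = ⊥-elim (∄Q (x , Qx))

  module _ (P : ℕ → X → Set) where

    Covers : ℕ → List X → Set
    Covers N rs = ∀ x → Any (AgreeBelow P N x) rs

    split : ℕ → X → List X
    split N r = sample (λ y → AgreeBelow P N y r × P N y)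
             ++ sample (λ y → AgreeBelow P N y r × ¬ P N y)

    representatives : ℕ → List X
    representatives zero    = sample (const ⊤)
    representatives (suc N) = concatMap (split N) (representatives N)

    representatives-cover : ∀ N → Covers N (representatives N)
    representatives-cover zero    x = Any.map (λ _ _ ()) (sample-complete (const ⊤) {x} tt)
    representatives-cover (suc N) x =
      concatMap⁺ (split N) (Any.map split-covers (representatives-cover N x))
      where
      split-covers : ∀ {r} → AgreeBelow P N x r → Any (AgreeBelow P (suc N) x) (split N r)
      split-covers {r} x~r with em {P N x}
      ... | yes Px = ++⁺ˡ (Any.map
        (λ (y~r , Py) → AgreeBelow-extend P (AgreeBelow-trans P x~r (AgreeBelow-sym P y~r))
                                            (mk⇔ (const Py) (const Px)))
        (sample-complete _ (x~r , Px)))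
      ... | no ¬Px = ++⁺ʳ (sample _) (Any.map
        (λ (y~r , ¬Py) → AgreeBelow-extend P (AgreeBelow-trans P x~r (AgreeBelow-sym P y~r))
                                             (mk⇔ (⊥-elim ∘ ¬Px) (⊥-elim ∘ ¬Py)))
        (sample-complete _ (x~r , ¬Px)))

module _ (F : Frame) (V : Valuation F) where

  Indistinguishable : ℕ → W F → W F → Set
  Indistinguishable N w w′ = ∀ ψ → VarsBelow N ψ → Sat F V w ψ ⇔ Sat F V w′ ψ

  Indistinguishable-refl : ∀ {N w} → Indistinguishable N w w
  Indistinguishable-refl _ _ = ⇔-refl

  sameSuccessors⇒indistinguishable : ∀ {N w w′} → (∀ v → R F w v ⇔ R F w′ v) →
    AgreeBelow V N w w′ → Indistinguishable N w w′
  sameSuccessors⇒indistinguishable R⇔ w~w′ (var p)  p<N         = w~w′ p p<N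
  sameSuccessors⇒indistinguishable R⇔ w~w′ ⊥'       _           = ⇔-refl
  sameSuccessors⇒indistinguishable R⇔ w~w′ (¬' ψ)   ψ<N         =
    ¬-cong-⇔ (sameSuccessors⇒indistinguishable R⇔ w~w′ ψ ψ<N)
  sameSuccessors⇒indistinguishable R⇔ w~w′ (ψ ∨' χ) (ψ<N , χ<N) =
    sameSuccessors⇒indistinguishable R⇔ w~w′ ψ ψ<N
      ⊎-⇔ sameSuccessors⇒indistinguishable R⇔ w~w′ χ χ<N
  sameSuccessors⇒indistinguishable R⇔ w~w′ (□ ψ)    _           =
    mk⇔ (λ □ψ v w′Rv → □ψ v (Equivalence.from (R⇔ v) w′Rv))
        (λ □ψ v wRv → □ψ v (Equivalence.to (R⇔ v) wRv))

record IsBoundedMorphismUpTo (N : ℕ) (F G : Frame) (V : Valuation G) (f : W F → W G) : Set where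
  field
    forth : ∀ {x y} → R F x y → R G (f x) (f y)
    back  : ∀ {x v} → R G (f x) v → ∃[ y ] R F x y × Indistinguishable G V N v (f y)

module _ {N F G V f} (bm : IsBoundedMorphismUpTo N F G V f) where
  open IsBoundedMorphismUpTo bm

  V∘f : Valuation F
  V∘f p = V p ∘ f

  sat-pullback⇔sat : ∀ ψ → VarsBelow N ψ → ∀ x → Sat F V∘f x ψ ⇔ Sat G V (f x) ψ
  sat-pullback⇔sat (var p)  _           x = ⇔-refl
  sat-pullback⇔sat ⊥'       _           x = ⇔-refl
  sat-pullback⇔sat (¬' ψ)   ψ<N         x = ¬-cong-⇔ (sat-pullback⇔sat ψ ψ<N x)
  sat-pullback⇔sat (ψ ∨' χ) (ψ<N , χ<N) x = sat-pullback⇔sat ψ ψ<N x ⊎-⇔ sat-pullback⇔sat χ χ<N x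
  sat-pullback⇔sat (□ ψ)    ψ<N         x = mk⇔ to from
    where
    to : Sat F V∘f x (□ ψ) → Sat G V (f x) (□ ψ)
    to □ψ v fxRv with back fxRv
    ... | y , xRy , v≈fy = Equivalence.from (v≈fy ψ ψ<N)
                             (Equivalence.to (sat-pullback⇔sat ψ ψ<N y) (□ψ y xRy))
    from : Sat G V (f x) (□ ψ) → Sat F V∘f x (□ ψ)
    from □ψ y xRy = Equivalence.from (sat-pullback⇔sat ψ ψ<N y) (□ψ (f y) (forth xRy))

sat-of-validIn : ∀ φ {F G V f w} → IsBoundedMorphismUpTo (varBound φ) F G V f → ValidIn F φ →
  ∀ x → Indistinguishable G V (varBound φ) w (f x) → Sat G V w φ
sat-of-validIn φ bm valid x w≈fx =
  Equivalence.from (w≈fx φ φ<N)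
    (Equivalence.to (sat-pullback⇔sat bm φ φ<N x) (valid (V∘f bm) x))
  where
  φ<N : VarsBelow (varBound φ) φ
  φ<N = VarsBelow-varBound φ

module GalaxyAsFlowerImage (em : ExcludedMiddle 0ℓ) {A B : Set} (ρ : A → B → Set)
                           (V : Valuation (galaxy A B ρ)) (N : ℕ) where

  Gal : Frame
  Gal = galaxy A B ρ

  Vᴮ : ℕ → B → Set
  Vᴮ p b = V p (inj₂ b)

  rs : List B
  rs = representatives em Vᴮ N

  n : ℕ
  n = length rs

  Flower : Frame
  Flower = flower 2 (nat n)

  B-agreeBelow⇒indistinguishable : ∀ {b b′} → AgreeBelow Vᴮ N b b′ →
    Indistinguishable Gal V N (inj₂ b) (inj₂ b′)
  B-agreeBelow⇒indistinguishable = sameSuccessors⇒indistinguishable Gal V sameSuccessors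
    where
    sameSuccessors : ∀ {b b′} v → galaxyR ρ (inj₂ b) v ⇔ galaxyR ρ (inj₂ b′) v
    sameSuccessors (inj₁ _) = ⇔-refl
    sameSuccessors (inj₂ _) = ⇔-refl

  module FlowerMap (s : A) {b₁ b₂ : B} (ρs : ∀ b → ρ s b ⇔ (b ≡ b₁ ⊎ b ≡ b₂)) where

    petal : ∀ i → i ≤ suc n → B
    petal 0             _         = b₁
    petal 1             _         = b₂
    petal (suc (suc k)) (s≤s k<n) = lookup rs (fromℕ< k<n)

    toGalaxy : W Flower → W Gal
    toGalaxy (zero  , _)         = inj₁ s
    toGalaxy (suc i , s≤s i≤1+n) = inj₂ (petal i i≤1+n)

    representativePoint : Fin n → W Flower
    representativePoint k = 3 + toℕ k , s≤s (s≤s (toℕ<n k))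

    toGalaxy-representativePoint : ∀ k → toGalaxy (representativePoint k) ≡ inj₂ (lookup rs k)
    toGalaxy-representativePoint k = ≡.cong (inj₂ ∘ lookup rs) (fromℕ<-toℕ k (toℕ<n k))

    represented : ∀ b →
      ∃[ k ] Indistinguishable Gal V N (inj₂ b) (toGalaxy (representativePoint k))
    represented b =
      k , ≡.subst (Indistinguishable Gal V N (inj₂ b)) (≡.sym (toGalaxy-representativePoint k))
                  (B-agreeBelow⇒indistinguishable (lookup-index b∈rs))
      where
      b∈rs : Any (AgreeBelow Vᴮ N b) rs
      b∈rs = representatives-cover em Vᴮ N b
      k : Fin n
      k = Any.index b∈rs

    toGalaxy-isBoundedMorphism : IsBoundedMorphismUpTo N Flower Gal V toGalaxy
    toGalaxy-isBoundedMorphism = record { forth = forth ; back = back }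
      where
      forth : ∀ {x y} → R Flower x y → R Gal (toGalaxy x) (toGalaxy y)
      forth {zero , _}      {1 , s≤s _}             _ = Equivalence.from (ρs b₁) (inj₁ refl)
      forth {zero , _}      {2 , s≤s _}             _ = Equivalence.from (ρs b₂) (inj₂ refl)
      forth {zero , _}      {zero , _}              (inj₁ (_ , () , _))
      forth {zero , _}      {suc (suc (suc _)) , _} (inj₁ (_ , _ , s≤s (s≤s ())))
      forth {zero , _}                              (inj₂ (() , _))
      forth {suc _ , s≤s _} {zero , _}              (inj₁ (() , _))
      forth {suc _ , s≤s _} {zero , _}              (inj₂ (_ , ()))
      forth {suc _ , s≤s _} {suc _ , s≤s _}         _ = tt

      back : ∀ {x v} → R Gal (toGalaxy x) v →
        ∃[ y ] R Flower x y × Indistinguishable Gal V N v (toGalaxy y)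
      back {zero , _} {inj₂ b} sRb with Equivalence.to (ρs b) sRb
      ... | inj₁ refl =
        (1 , s≤s z≤n) , inj₁ (refl , s≤s z≤n , s≤s z≤n) , Indistinguishable-refl Gal V
      ... | inj₂ refl =
        (2 , s≤s (s≤s z≤n)) , inj₁ (refl , s≤s z≤n , s≤s (s≤s z≤n)) , Indistinguishable-refl Gal V
      back {suc _ , s≤s _} {inj₂ b} _ with represented b
      ... | k , b≈ = representativePoint k , inj₂ (s≤s z≤n , s≤s z≤n) , b≈

lemma36 : ExcludedMiddle 0ℓ →
    (L : Fm → Set) → EuclideanLogic L →
    (A B : Set) (ρ : A → B → Set) → InK2 A B ρ →
    (∀ n → InS L 2 n) →
    Validates (galaxy A B ρ) L
lemma36 em L _ A B ρ (|A|≥4 , _ , ρ-two) S₂ φ Lφ V = sat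
  where
  open GalaxyAsFlowerImage em ρ V (varBound φ)
  module At (s : A) = FlowerMap s (proj₂ (proj₂ (proj₂ (ρ-two s))))

  valid : ValidIn Flower φ
  valid = proj₂ (S₂ (nat n)) φ Lφ

  s₀ : A
  s₀ = proj₁ |A|≥4 Fin.zero

  sat : ∀ w → Sat Gal V w φ
  sat (inj₁ s) = sat-of-validIn φ (At.toGalaxy-isBoundedMorphism s) valid
                   (zero , z≤n) (Indistinguishable-refl Gal V)
  sat (inj₂ b) with At.represented s₀ b
  ... | k , b≈ = sat-of-validIn φ (At.toGalaxy-isBoundedMorphism s₀) valid
                   (At.representativePoint s₀ k) b≈
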